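{- There are infinitely many rational numbers $x$ such that $x$ has at least three different representations of the form $$x=\sum_{i=1}^{\infty}\frac{a_{i}}{2^{a_{i}}},$$ where $(a_i)_{i\geq 1}$ is a strictly increasing sequence of positive integers.
   Context: Two representations are different if the corresponding strictly increasing sequences $(a_i)$ differ. -}

module Defs where

open import Data.Nat as ℕ using (ℕ; zero; suc)
open import Data.Integer using (+_)
open import Data.Rational using (ℚ; _+_; _*_; _-_; ∣_∣; _<_; 0ℚ; 1ℚ; ½; _/_)
open import Data.Product using (Σ; ∃; ∃-syntax; _×_; _,_)
open import Relation.Binary.PropositionalEquality using (_≡_; _≢_)
open import Data.List using (List)
open import Data.List.Membership.Propositional using (_∉_)

half^ : ℕ → ℚ
half^ zero    = 1ℚ
half^ (suc n) = ½ * half^ n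

term : ℕ → ℚ
term a = (+ a / 1) * half^ a

-- partial sum  Σ_{i < n} a_i / 2^{a_i}   (sequence indexed from 0: a 0 = a_1)
partialSum : (ℕ → ℕ) → ℕ → ℚ
partialSum a zero    = 0ℚ
partialSum a (suc n) = partialSum a n + term (a n)

StrictIncPos : (ℕ → ℕ) → Set
StrictIncPos a = (∀ i → 0 ℕ.< a i) × (∀ i → a i ℕ.< a (suc i))

SumsTo : (ℕ → ℕ) → ℚ → Set
SumsTo a x = ∀ (ε : ℚ) → 0ℚ < ε → ∃[ N ] (∀ n → N ℕ.≤ n → ∣ partialSum a n - x ∣ < ε)

IsRep : ℚ → (ℕ → ℕ) → Set
IsRep x a = StrictIncPos a × SumsTo a x

Differ : (ℕ → ℕ) → (ℕ → ℕ) → Set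
Differ a b = ∃[ i ] (a i ≢ b i)

HasThreeReps : ℚ → Set
HasThreeReps x =
  ∃[ a ] ∃[ b ] ∃[ c ]
    (IsRep x a × IsRep x b × IsRep x c ×
     Differ a b × Differ a c × Differ b c)

InfinitelyMany : (ℚ → Set) → Set
InfinitelyMany P = ∀ (xs : List ℚ) → ∃[ x ] (x ∉ xs × P x)

-- Summing n/2ⁿ telescopically gives Σ_{n>k} n/2ⁿ = (k+2)/2ᵏ, and
-- 1/2 = 1/2¹ = 2/2² = 3/2³ + 6/2⁶ + 8/2⁸.  Hence for k ≥ 8 the rational ½ + (k+2)/2ᵏ is
-- represented by (1, k+1, k+2, …), (2, k+1, k+2, …) and (3, 6, 8, k+1, k+2, …).
-- These rationals all exceed ½ and tend to ½, so no finite list contains all of them.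
module Submission where

open import Defs
open import Data.Nat as ℕ using (ℕ; zero; suc; z≤n; s≤s)
import Data.Nat.Properties as ℕ
open import Data.Nat.Tactic.RingSolver using (solve-∀)
open import Data.Nat.Coprimality using (Coprime)
open import Data.Integer as ℤ using (+_; +[1+_]; -[1+_])
import Data.Integer.Properties as ℤ
open import Data.Rational
open import Data.Rational.Properties
open import Data.Rational.Literals using (fromℤ)
open import Data.Rational.Solver using (module +-*-Solver)
import Data.Rational.Unnormalised.Base as ℚᵘ using (*≡*)
import Data.Rational.Unnormalised.Properties as ℚᵘ
open import Data.Product using (∃-syntax; _×_; _,_)
open import Data.List using ([]; _∷_)
open import Data.List.Relation.Unary.Any using (here; there)
open import Data.List.Membership.Propositional using (_∉_)
open import Relation.Nullary using (yes; no)
open import Relation.Binary.PropositionalEquality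

open +-*-Solver

Eventually : (ℕ → Set) → Set
Eventually P = ∃[ N ] (∀ n → N ℕ.≤ n → P n)

module _ {P Q : ℕ → Set} where

  eventually-mono : (∀ {n} → P n → Q n) → Eventually P → Eventually Q
  eventually-mono P⇒Q (N , p) = N , λ n N≤n → P⇒Q (p n N≤n)

  eventually-∧ : Eventually P → Eventually Q → Eventually (λ n → P n × Q n)
  eventually-∧ (M , p) (N , q) =
    M ℕ.⊔ N , λ n M⊔N≤n → p n (ℕ.≤-trans (ℕ.m≤m⊔n M N) M⊔N≤n) , q n (ℕ.≤-trans (ℕ.m≤n⊔m M N) M⊔N≤n)

eventually-shift : ∀ {P} k → Eventually P → Eventually (λ j → P (k ℕ.+ j))
eventually-shift k (N , p) = N , λ j N≤j → p (k ℕ.+ j) (ℕ.≤-trans N≤j (ℕ.m≤n+m j k))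

eventually-∉ : {A : Set} (f : ℕ → A) → (∀ z → Eventually (λ n → f n ≢ z)) →
               ∀ xs → Eventually (λ n → f n ∉ xs)
eventually-∉ f avoids []       = 0 , λ _ _ ()
eventually-∉ f avoids (z ∷ zs) = eventually-mono ∉-∷ (eventually-∧ (avoids z) (eventually-∉ f avoids zs))
  where
  ∉-∷ : ∀ {n} → f n ≢ z × f n ∉ zs → f n ∉ z ∷ zs
  ∉-∷ (f≢z , f∉zs) (here f≡z)   = f≢z f≡z
  ∉-∷ (f≢z , f∉zs) (there f∈zs) = f∉zs f∈zs

infinitelyMany-of-sequence : ∀ {P} (f : ℕ → ℚ) → (∀ z → Eventually (λ n → f n ≢ z)) →
                             Eventually (λ n → P (f n)) → InfinitelyMany P
infinitelyMany-of-sequence f avoids Pf xs with eventually-∧ (eventually-∉ f avoids xs) Pf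
... | N , p = f N , p N ℕ.≤-refl

-- Built with `fromℤ`, not as `+ n / 1` like `term`, so that `toℚᵘ (fromℕ n)` computes.
fromℕ : ℕ → ℚ
fromℕ n = fromℤ (+ n)

fromℕ-/1 : ∀ n → + n / 1 ≡ fromℕ n
fromℕ-/1 n = ↥p/↧p≡p (fromℕ n)

fromℕ-+ : ∀ m n → fromℕ (m ℕ.+ n) ≡ fromℕ m + fromℕ n
fromℕ-+ m n = toℚᵘ-injective
  (ℚᵘ.≃-trans (ℚᵘ.*≡* (cong (ℤ._* + 1) numerators)) (ℚᵘ.≃-sym (toℚᵘ-homo-+ (fromℕ m) (fromℕ n))))
  where
  numerators : + (m ℕ.+ n) ≡ + m ℤ.* + 1 ℤ.+ + n ℤ.* + 1
  numerators = trans (ℤ.pos-+ m n) (sym (cong₂ ℤ._+_ (ℤ.*-identityʳ (+ m)) (ℤ.*-identityʳ (+ n))))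

fromℕ-* : ∀ m n → fromℕ (m ℕ.* n) ≡ fromℕ m * fromℕ n
fromℕ-* m n = toℚᵘ-injective
  (ℚᵘ.≃-trans (ℚᵘ.*≡* (cong (ℤ._* + 1) (ℤ.pos-* m n))) (ℚᵘ.≃-sym (toℚᵘ-homo-* (fromℕ m) (fromℕ n))))

fromℕ-mono-≤ : ∀ {m n} → m ℕ.≤ n → fromℕ m ≤ fromℕ n
fromℕ-mono-≤ {m} {n} m≤n =
  *≤* (subst₂ ℤ._≤_ (sym (ℤ.*-identityʳ (+ m))) (sym (ℤ.*-identityʳ (+ n))) (ℤ.+≤+ m≤n))

fromℕ-mono-< : ∀ {m n} → m ℕ.< n → fromℕ m < fromℕ n
fromℕ-mono-< {m} {n} m<n =
  *<* (subst₂ ℤ._<_ (sym (ℤ.*-identityʳ (+ m))) (sym (ℤ.*-identityʳ (+ n))) (ℤ.+<+ m<n))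

mkℚ*↧≡↥ : ∀ n d .(c : Coprime (suc n) (suc d)) → mkℚ +[1+ n ] d c * fromℕ (suc d) ≡ fromℕ (suc n)
mkℚ*↧≡↥ n d c = toℚᵘ-injective (ℚᵘ.≃-trans (toℚᵘ-homo-* (mkℚ +[1+ n ] d c) (fromℕ (suc d)))
  (ℚᵘ.*≡* (trans (ℤ.*-identityʳ _) (cong (λ k → +[1+ n ] ℤ.* + suc k) (sym (ℕ.*-identityʳ d))))))

archimedean : ∀ c ε → 0ℚ < ε → ∃[ N ] fromℕ c < ε * fromℕ N
archimedean c ε@(mkℚ +[1+ n ] d coprime) _ = suc d ℕ.* suc c , (begin-strict
  fromℕ c                                ≤⟨ fromℕ-mono-≤ (ℕ.m≤n*m c (suc n)) ⟩
  fromℕ (suc n ℕ.* c)                    <⟨ fromℕ-mono-< (ℕ.*-monoʳ-< (suc n) (ℕ.n<1+n c)) ⟩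
  fromℕ (suc n ℕ.* suc c)                ≡⟨ fromℕ-* (suc n) (suc c) ⟩
  fromℕ (suc n) * fromℕ (suc c)          ≡⟨ cong (_* fromℕ (suc c)) (mkℚ*↧≡↥ n d coprime) ⟨
  ε * fromℕ (suc d) * fromℕ (suc c)      ≡⟨ *-assoc ε (fromℕ (suc d)) (fromℕ (suc c)) ⟩
  ε * (fromℕ (suc d) * fromℕ (suc c))    ≡⟨ cong (ε *_) (fromℕ-* (suc d) (suc c)) ⟨
  ε * fromℕ (suc d ℕ.* suc c)            ∎)
  where open ≤-Reasoning
archimedean c (mkℚ (+ 0) _ _) 0<ε with positive 0<ε
... | ()
archimedean c (mkℚ -[1+ _ ] _ _) 0<ε with positive 0<ε
... | ()

TendsToZero : (ℕ → ℚ) → Set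
TendsToZero r = ∀ ε → 0ℚ < ε → Eventually (λ n → r n < ε)

tendsToZero-shift : ∀ {r} k → TendsToZero r → TendsToZero (λ j → r (k ℕ.+ j))
tendsToZero-shift k r→0 ε 0<ε = eventually-shift k (r→0 ε 0<ε)

tendsToZero-≤c/1+n : ∀ (r : ℕ → ℚ) c → (∀ n → fromℕ (suc n) * r n ≤ fromℕ c) → TendsToZero r
tendsToZero-≤c/1+n r c bound ε 0<ε with archimedean c ε 0<ε
... | N , c<εN = N , λ n N≤n → *-cancelˡ-<-nonNeg (fromℕ (suc n)) (begin-strict
  fromℕ (suc n) * r n   ≤⟨ bound n ⟩
  fromℕ c               <⟨ c<εN ⟩
  ε * fromℕ N           ≤⟨ *-monoˡ-≤-nonNeg ε {{nonNegative (<⇒≤ 0<ε)}} (fromℕ-mono-≤ (ℕ.m≤n⇒m≤1+n N≤n)) ⟩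
  ε * fromℕ (suc n)     ≡⟨ *-comm ε (fromℕ (suc n)) ⟩
  fromℕ (suc n) * ε     ∎)
  where open ≤-Reasoning

eventually-+-≢ : ∀ c (r : ℕ → ℚ) → (∀ n → 0ℚ < r n) → TendsToZero r →
                 ∀ z → Eventually (λ n → c + r n ≢ z)
eventually-+-≢ c r r>0 r→0 z with c <? z
... | yes c<z = eventually-mono c+r≢z (r→0 (z - c) 0<z-c)
  where
  0<z-c : 0ℚ < z - c
  0<z-c = subst (_< z - c) (+-inverseʳ c) (+-monoˡ-< (- c) c<z)
  c+r≢z : ∀ {n} → r n < z - c → c + r n ≢ z
  c+r≢z {n} r<z-c eq = <-irrefl eq
    (subst (c + r n <_) (solve 2 (λ c z → c :+ (z :- c) := z) refl c z) (+-monoʳ-< c r<z-c))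
... | no c≮z = 0 , λ n _ eq → <-irrefl (sym eq)
  (≤-<-trans (≮⇒≥ c≮z) (subst (_< c + r n) (+-identityʳ c) (+-monoʳ-< c (r>0 n))))

_∷ₛ_ : ℕ → (ℕ → ℕ) → ℕ → ℕ
(x ∷ₛ a) zero    = x
(x ∷ₛ a) (suc i) = a i

infixr 5 _∷ₛ_

partialSum-∷ₛ : ∀ x a n → partialSum (x ∷ₛ a) (suc n) ≡ term x + partialSum a n
partialSum-∷ₛ x a zero    = +-comm 0ℚ (term x)
partialSum-∷ₛ x a (suc n) =
  trans (cong (_+ term (a n)) (partialSum-∷ₛ x a n)) (+-assoc (term x) (partialSum a n) (term (a n)))

sumsTo-∷ₛ : ∀ {x a y} → SumsTo a y → SumsTo (x ∷ₛ a) (term x + y)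
sumsTo-∷ₛ {x} {a} {y} a→y ε 0<ε with a→y ε 0<ε
... | N , close = suc N , close-∷ₛ
  where
  shifted : ∀ n → partialSum (x ∷ₛ a) (suc n) - (term x + y) ≡ partialSum a n - y
  shifted n = trans (cong (_- (term x + y)) (partialSum-∷ₛ x a n))
    (solve 3 (λ t s y → (t :+ s) :- (t :+ y) := s :- y) refl (term x) (partialSum a n) y)
  close-∷ₛ : ∀ n → suc N ℕ.≤ n → ∣ partialSum (x ∷ₛ a) n - (term x + y) ∣ < ε
  close-∷ₛ (suc n) (s≤s N≤n) = subst (λ s → ∣ s ∣ < ε) (sym (shifted n)) (close n N≤n)

isRep-∷ₛ : ∀ {x y a} → 0 ℕ.< x → x ℕ.< a 0 → IsRep y a → IsRep (term x + y) (x ∷ₛ a)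
isRep-∷ₛ {x} {y} {a} 0<x x<a₀ ((a>0 , a↑) , a→y) = (all-positive , increasing) , sumsTo-∷ₛ a→y
  where
  all-positive : ∀ i → 0 ℕ.< (x ∷ₛ a) i
  all-positive zero    = 0<x
  all-positive (suc i) = a>0 i
  increasing : ∀ i → (x ∷ₛ a) i ℕ.< (x ∷ₛ a) (suc i)
  increasing zero    = x<a₀
  increasing (suc i) = a↑ i

sumsTo-of-remainder : ∀ a x (r : ℕ → ℚ) → (∀ n → partialSum a n + r n ≡ x) →
                      (∀ n → 0ℚ ≤ r n) → TendsToZero r → SumsTo a x
sumsTo-of-remainder a x r split r≥0 r→0 ε 0<ε = eventually-mono close (r→0 ε 0<ε)
  where
  close : ∀ {n} → r n < ε → ∣ partialSum a n - x ∣ < ε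
  close {n} r<ε = subst (_< ε) (sym (begin
    ∣ partialSum a n - x ∣                  ≡⟨ cong (λ s → ∣ partialSum a n - s ∣) (split n) ⟨
    ∣ partialSum a n - (partialSum a n + r n) ∣
      ≡⟨ cong ∣_∣ (solve 2 (λ s r → s :- (s :+ r) := :- r) refl (partialSum a n) (r n)) ⟩
    ∣ - r n ∣                               ≡⟨ ∣-p∣≡∣p∣ (r n) ⟩
    ∣ r n ∣                                 ≡⟨ 0≤p⇒∣p∣≡p (r≥0 n) ⟩
    r n                                     ∎)) r<ε
    where open ≡-Reasoning

half^-pos : ∀ k → Positive (half^ k)
half^-pos zero    = _
half^-pos (suc k) = pos*pos⇒pos ½ (half^ k) {{half^-pos k}}

fromℕ[2^k]*half^k≡1 : ∀ k → fromℕ (2 ℕ.^ k) * half^ k ≡ 1ℚ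
fromℕ[2^k]*half^k≡1 zero    = refl
fromℕ[2^k]*half^k≡1 (suc k) = begin
  fromℕ (2 ℕ.* 2 ℕ.^ k) * (½ * half^ k)       ≡⟨ cong (_* (½ * half^ k)) (fromℕ-* 2 (2 ℕ.^ k)) ⟩
  fromℕ 2 * fromℕ (2 ℕ.^ k) * (½ * half^ k)   ≡⟨ solve 2 (λ p h → con (fromℕ 2) :* p :* (con ½ :* h) := p :* h)
                                                    refl (fromℕ (2 ℕ.^ k)) (half^ k) ⟩
  fromℕ (2 ℕ.^ k) * half^ k                   ≡⟨ fromℕ[2^k]*half^k≡1 k ⟩
  1ℚ                                          ∎
  where open ≡-Reasoning

term≡ : ∀ a → term a ≡ fromℕ a * half^ a
term≡ a = cong (_* half^ a) (fromℕ-/1 a)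

remainder : ℕ → ℚ
remainder k = fromℕ (2 ℕ.+ k) * half^ k

remainder-pos : ∀ k → 0ℚ < remainder k
remainder-pos k = positive⁻¹ (remainder k) {{pos*pos⇒pos (fromℕ (2 ℕ.+ k)) (half^ k) {{half^-pos k}}}}

term+remainder : ∀ m → term (suc m) + remainder (suc m) ≡ remainder m
term+remainder m = begin
  term (suc m) + remainder (suc m)
    ≡⟨ cong (_+ remainder (suc m)) (term≡ (suc m)) ⟩
  fromℕ (1 ℕ.+ m) * (½ * h) + fromℕ (3 ℕ.+ m) * (½ * h)
    ≡⟨ cong₂ (λ p q → p * (½ * h) + q * (½ * h)) (fromℕ-+ 1 m) (fromℕ-+ 3 m) ⟩
  (fromℕ 1 + fromℕ m) * (½ * h) + (fromℕ 3 + fromℕ m) * (½ * h)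
    ≡⟨ solve 2 (λ x h → (con (fromℕ 1) :+ x) :* (con ½ :* h) :+ (con (fromℕ 3) :+ x) :* (con ½ :* h)
                        := (con (fromℕ 2) :+ x) :* h) refl (fromℕ m) h ⟩
  (fromℕ 2 + fromℕ m) * h
    ≡⟨ cong (_* h) (fromℕ-+ 2 m) ⟨
  remainder m ∎
  where
  h : ℚ
  h = half^ m
  open ≡-Reasoning

upFrom : ℕ → ℕ → ℕ
upFrom k i = k ℕ.+ i

partialSum-upFrom : ∀ k j → partialSum (upFrom (suc k)) j + remainder (k ℕ.+ j) ≡ remainder k
partialSum-upFrom k zero    = trans (+-identityˡ _) (cong remainder (ℕ.+-identityʳ k))
partialSum-upFrom k (suc j) = begin
  S + term (suc m) + remainder (k ℕ.+ suc j)    ≡⟨ cong (λ i → S + term (suc m) + remainder i) (ℕ.+-suc k j) ⟩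
  S + term (suc m) + remainder (suc m)          ≡⟨ +-assoc S (term (suc m)) (remainder (suc m)) ⟩
  S + (term (suc m) + remainder (suc m))        ≡⟨ cong (λ t → S + t) (term+remainder m) ⟩
  S + remainder m                               ≡⟨ partialSum-upFrom k j ⟩
  remainder k                                   ∎
  where
  S : ℚ
  S = partialSum (upFrom (suc k)) j
  m : ℕ
  m = k ℕ.+ j
  open ≡-Reasoning

2+n≤2^[1+n] : ∀ n → 2 ℕ.+ n ℕ.≤ 2 ℕ.^ suc n
2+n≤2^[1+n] zero    = ℕ.≤-refl
2+n≤2^[1+n] (suc n) =
  ℕ.≤-trans (ℕ.+-mono-≤ (ℕ.m^n>0 2 (suc n)) (2+n≤2^[1+n] n)) (ℕ.≤-reflexive (double (2 ℕ.^ suc n)))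
  where
  double : ∀ p → p ℕ.+ p ≡ 2 ℕ.* p
  double = solve-∀

[1+n][2+n]≤4*2^n : ∀ n → suc n ℕ.* (2 ℕ.+ n) ℕ.≤ 4 ℕ.* 2 ℕ.^ n
[1+n][2+n]≤4*2^n zero    = ℕ.+-monoʳ-≤ 2 z≤n
[1+n][2+n]≤4*2^n (suc n) = begin
  (2 ℕ.+ n) ℕ.* (3 ℕ.+ n)                        ≡⟨ expand n ⟩
  suc n ℕ.* (2 ℕ.+ n) ℕ.+ 2 ℕ.* (2 ℕ.+ n)        ≤⟨ ℕ.+-mono-≤ ([1+n][2+n]≤4*2^n n) (ℕ.*-monoʳ-≤ 2 (2+n≤2^[1+n] n)) ⟩
  4 ℕ.* 2 ℕ.^ n ℕ.+ 2 ℕ.* (2 ℕ.* 2 ℕ.^ n)        ≡⟨ collect (2 ℕ.^ n) ⟩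
  4 ℕ.* 2 ℕ.^ suc n                              ∎
  where
  open ℕ.≤-Reasoning
  expand : ∀ n → (2 ℕ.+ n) ℕ.* (3 ℕ.+ n) ≡ suc n ℕ.* (2 ℕ.+ n) ℕ.+ 2 ℕ.* (2 ℕ.+ n)
  expand = solve-∀
  collect : ∀ p → 4 ℕ.* p ℕ.+ 2 ℕ.* (2 ℕ.* p) ≡ 4 ℕ.* (2 ℕ.* p)
  collect = solve-∀

[1+n]*remainder≤4 : ∀ n → fromℕ (suc n) * remainder n ≤ fromℕ 4
[1+n]*remainder≤4 n = begin
  fromℕ (suc n) * (fromℕ (2 ℕ.+ n) * h)       ≡⟨ *-assoc (fromℕ (suc n)) (fromℕ (2 ℕ.+ n)) h ⟨
  fromℕ (suc n) * fromℕ (2 ℕ.+ n) * h         ≡⟨ cong (_* h) (fromℕ-* (suc n) (2 ℕ.+ n)) ⟨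
  fromℕ (suc n ℕ.* (2 ℕ.+ n)) * h             ≤⟨ *-monoʳ-≤-nonNeg h {{pos⇒nonNeg h {{half^-pos n}}}}
                                                   (fromℕ-mono-≤ ([1+n][2+n]≤4*2^n n)) ⟩
  fromℕ (4 ℕ.* 2 ℕ.^ n) * h                   ≡⟨ cong (_* h) (fromℕ-* 4 (2 ℕ.^ n)) ⟩
  fromℕ 4 * fromℕ (2 ℕ.^ n) * h               ≡⟨ *-assoc (fromℕ 4) (fromℕ (2 ℕ.^ n)) h ⟩
  fromℕ 4 * (fromℕ (2 ℕ.^ n) * h)             ≡⟨ cong (fromℕ 4 *_) (fromℕ[2^k]*half^k≡1 n) ⟩
  fromℕ 4 * 1ℚ                                ≡⟨ *-identityʳ (fromℕ 4) ⟩
  fromℕ 4                                     ∎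
  where
  h : ℚ
  h = half^ n
  open ≤-Reasoning

remainder→0 : TendsToZero remainder
remainder→0 = tendsToZero-≤c/1+n remainder 4 [1+n]*remainder≤4

isRep-upFrom : ∀ k → IsRep (remainder k) (upFrom (suc k))
isRep-upFrom k = ((λ _ → s≤s z≤n) , (λ i → ℕ.+-monoʳ-< (suc k) (ℕ.n<1+n i))) ,
  sumsTo-of-remainder (upFrom (suc k)) (remainder k) (λ j → remainder (k ℕ.+ j))
    (partialSum-upFrom k) (λ j → <⇒≤ (remainder-pos (k ℕ.+ j))) (tendsToZero-shift k remainder→0)

hasThreeReps : ∀ k → 8 ℕ.≤ k → HasThreeReps (½ + remainder k)
hasThreeReps k 8≤k =
  1 ∷ₛ tail , 2 ∷ₛ tail , 3 ∷ₛ 6 ∷ₛ 8 ∷ₛ tail ,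
  isRep-∷ₛ (s≤s z≤n) (below-tail 1 (s≤s z≤n)) (isRep-upFrom k) ,
  isRep-∷ₛ (s≤s z≤n) (below-tail 2 (s≤s (s≤s z≤n))) (isRep-upFrom k) ,
  subst (λ x → IsRep x (3 ∷ₛ 6 ∷ₛ 8 ∷ₛ tail)) ½-as-3,6,8
    (isRep-∷ₛ (s≤s z≤n) (ℕ.+-monoʳ-≤ 4 z≤n)
      (isRep-∷ₛ (s≤s z≤n) (ℕ.+-monoʳ-≤ 7 z≤n)
        (isRep-∷ₛ (s≤s z≤n) (below-tail 8 ℕ.≤-refl) (isRep-upFrom k)))) ,
  (0 , λ ()) , (0 , λ ()) , (0 , λ ())
  where
  tail : ℕ → ℕ
  tail = upFrom (suc k)
  below-tail : ∀ m → m ℕ.≤ 8 → m ℕ.< tail 0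
  below-tail m m≤8 = s≤s (ℕ.m≤n⇒m≤n+o 0 (ℕ.≤-trans m≤8 8≤k))
  ½-as-3,6,8 : term 3 + (term 6 + (term 8 + remainder k)) ≡ ½ + remainder k
  ½-as-3,6,8 = solve 1 (λ r → con (term 3) :+ (con (term 6) :+ (con (term 8) :+ r)) := con ½ :+ r) refl (remainder k)

corollary2p6 : InfinitelyMany HasThreeReps
corollary2p6 = infinitelyMany-of-sequence (λ k → ½ + remainder k)
  (eventually-+-≢ ½ remainder remainder-pos remainder→0)
  (8 , hasThreeReps)
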